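{- Let $m$ be a positive integer such that $P_{m,0}$ holds. Then $P_{m,n}$ holds for every nonnegative integer $n$.
   Context: Let $\mathcal{A}=\bigl(\prod_{p}\mathbb{Z}/p\mathbb{Z}\bigr)/\bigl(\bigoplus_{p}\mathbb{Z}/p\mathbb{Z}\bigr)$, $p$ over all primes (families agreeing for all but finitely many $p$ are identified). For positive integers $k_1,\dots,k_n$ let $\zeta_{\mathcal{A}}(k_1,\dots,k_n)=\bigl(\sum_{p>m_1>\dots>m_n\ge1} m_1^{ -k_1}\cdots m_n^{ -k_n}\bmod p\bigr)_p$ and $\zeta^{\star}_{\mathcal{A}}(k_1,\dots,k_n)$ the same with $p>m_1\ge\dots\ge m_n\ge1$. Let $\mathfrak{H}^1=\mathbb{Q}\langle z_1,z_2,\dots\rangle$ (noncommutative polynomials). The shuffle product $\sqcup\!\sqcup$ is the $\mathbb{Q}$-bilinear map with $1\sqcup\!\sqcup w=w\sqcup\!\sqcup 1=w$, $z_kw\sqcup\!\sqcup z_{k'}w'=z_k(w\sqcup\!\sqcup z_{k'}w')+z_{k'}(z_kw\sqcup\!\sqcup w')$. $Z_{\mathcal{A}},\bar Z_{\mathcal{A}}:\mathfrak{H}^1\to\mathcal{A}$ are $\mathbb{Q}$-linear with $Z_{\mathcal{A}}(1)=\bar Z_{\mathcal{A}}(1)=1$, $Z_{\mathcal{A}}(z_{k_1}\cdots z_{k_l})=\zeta_{\mathcal{A}}(k_1,\dots,k_l)$, $\bar Z_{\mathcal{A}}(z_{k_1}\cdots z_{k_l})=\zeta^\star_{\mathcal{A}}(k_1,\dots,k_l)$.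 For $(m,n)\in\mathbb{Z}_{\ge0}^2\setminus\{(0,0)\}$, $I_{m,n}$ is the set of tuples $\mathbf{a}=(a_1,\dots,a_m;b_1,\dots,b_m;c_1,\dots,c_n)$ with $a_i,b_i$ odd positive integers and $c_j$ even positive integers, and $z_{\mathbf{a}}=\sum_{\sigma,\tau\in S_m} z_{a_{\sigma(1)}}z_{b_{\tau(1)}}\cdots z_{a_{\sigma(m)}}z_{b_{\tau(m)}}\sqcup\!\sqcup z_{c_1}\sqcup\!\sqcup\cdots\sqcup\!\sqcup z_{c_n}$ ($S_m$ the symmetric group). $P_{m,n}$ denotes the statement: $Z_{\mathcal{A}}(z_{\mathbf{a}})=\bar Z_{\mathcal{A}}(z_{\mathbf{a}})=0$ for all $\mathbf{a}\in I_{m,n}$. -}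

module Defs where

open import Data.Nat using (ℕ; zero; suc; _+_; _*_; _<_)
open import Data.Nat.Divisibility using (_∣_)
open import Data.Nat.Primality using (Prime)
open import Data.Integer using (+_; ∣_∣)
open import Data.Rational using (ℚ; 0ℚ; 1ℚ; ↥_) renaming (_+_ to _+ℚ_; _*_ to _*ℚ_; _/_ to _/ℚ_)
open import Data.List using (List; []; _∷_; [_]; map; _++_; concatMap; foldr)
open import Data.Vec using (Vec; toList)
open import Data.Vec.Relation.Unary.All using (All)
open import Data.Product using (∃; _×_)
open import Relation.Binary.PropositionalEquality using (_≡_)

-- Words in the letters z_k are lists of positive integers k (index k of z_k).
-- An element of 𝔥¹ with nonnegative integer coefficients is represented as a
-- formal sum of words, i.e. a list of words (multiplicity = coefficient).
Word : Set
Word = List ℕ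

FormalSum : Set
FormalSum = List Word

shuffleW : Word → Word → FormalSum
shuffleW [] v = [ v ]
shuffleW (x ∷ u) [] = [ x ∷ u ]
shuffleW (x ∷ u) (y ∷ v) = map (x ∷_) (shuffleW u (y ∷ v)) ++ map (y ∷_) (shuffleW (x ∷ u) v)

shuffle : FormalSum → FormalSum → FormalSum
shuffle s t = concatMap (λ u → concatMap (λ v → shuffleW u v) t) s

-- all m! rearrangements of a list of length m (one per permutation σ ∈ S_m,
-- repeated entries counted with multiplicity)
insertions : ℕ → List ℕ → List (List ℕ)
insertions x [] = [ [ x ] ]
insertions x (y ∷ ys) = (x ∷ y ∷ ys) ∷ map (y ∷_) (insertions x ys)

perms : List ℕ → List (List ℕ)
perms [] = [ [] ]
perms (x ∷ xs) = concatMap (insertions x) (perms xs)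

interleave : List ℕ → List ℕ → Word
interleave [] _ = []
interleave (x ∷ xs) [] = x ∷ xs
interleave (x ∷ xs) (y ∷ ys) = x ∷ y ∷ interleave xs ys

-- z_𝐚 = Σ_{σ,τ ∈ S_m} z_{a_σ(1)} z_{b_τ(1)} ⋯ z_{a_σ(m)} z_{b_τ(m)} ⧢ z_{c_1} ⧢ ⋯ ⧢ z_{c_n}
zElem : ∀ {m n} → Vec ℕ m → Vec ℕ m → Vec ℕ n → FormalSum
zElem a b c =
  shuffle (concatMap (λ σa → map (λ τb → interleave σa τb) (perms (toList b))) (perms (toList a)))
          (foldr (λ k acc → shuffle [ [ k ] ] acc) [ [] ] (toList c))

invPow : ℕ → ℕ → ℚ
invPow j zero = 1ℚ
invPow j (suc k) = ((+ 1) /ℚ (suc j)) *ℚ invPow j k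

sumBelow : ℕ → (ℕ → ℚ) → ℚ
sumBelow zero f = 0ℚ
sumBelow (suc N) f = f N +ℚ sumBelow N f

-- zetaSum N (k₁,…,k_l) = Σ_{N > m₁ > ⋯ > m_l ≥ 1} m₁^{-k₁} ⋯ m_l^{-k_l}   (in ℚ)
-- (m = j+1 ranges over 1 … N-1, i.e. j over 0 … N-2)
zetaSum : ℕ → Word → ℚ
zetaSum N [] = 1ℚ
zetaSum zero (k ∷ ks) = 0ℚ
zetaSum (suc N) (k ∷ ks) = sumBelow N (λ j → invPow j k *ℚ zetaSum (suc j) ks)

-- zetaStarSum N (k₁,…,k_l) = Σ_{N > m₁ ≥ ⋯ ≥ m_l ≥ 1} m₁^{-k₁} ⋯ m_l^{-k_l}
zetaStarSum : ℕ → Word → ℚ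
zetaStarSum N [] = 1ℚ
zetaStarSum zero (k ∷ ks) = 0ℚ
zetaStarSum (suc N) (k ∷ ks) = sumBelow N (λ j → invPow j k *ℚ zetaStarSum (suc (suc j)) ks)

-- p-components of Z_𝒜(w) and Z̄_𝒜(w) (as rationals whose denominators are prime to p)
ZAp : ℕ → FormalSum → ℚ
ZAp p w = foldr (λ u acc → zetaSum p u +ℚ acc) 0ℚ w

ZbarAp : ℕ → FormalSum → ℚ
ZbarAp p w = foldr (λ u acc → zetaStarSum p u +ℚ acc) 0ℚ w

-- a family (x_p)_p of rationals (each p-integral for large p) is 0 in 𝒜 iff
-- x_p ≡ 0 mod p for all but finitely many primes p
IsZeroA : (ℕ → ℚ) → Set
IsZeroA x = ∃ λ N → ∀ p → Prime p → N < p → p ∣ ∣ ↥ (x p) ∣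

OddPos : ℕ → Set
OddPos k = ∃ λ j → k ≡ 2 * j + 1

EvenPos : ℕ → Set
EvenPos k = ∃ λ j → k ≡ 2 * suc j

P : ℕ → ℕ → Set
P m n = (a b : Vec ℕ m) (c : Vec ℕ n) → All OddPos a → All OddPos b → All EvenPos c →
        IsZeroA (λ p → ZAp p (zElem a b c)) × IsZeroA (λ p → ZbarAp p (zElem a b c))

-- For one letter z_c the harmonic product of the truncated sums gives
--   ζ(c) ζ(w) = ζ(z_c ⧢ w) + ζ(c ⊕ w)   and   ζ★(c) ζ★(w) = ζ★(z_c ⧢ w) − ζ★(c ⊕ w),
-- where c ⊕ w is the sum of the words obtained from w by adding c to one of its letters.
-- Contraction by c is a derivation of the shuffle algebra and commutes with the symmetrisation
-- over S_m × S_m, so for even c, c ⊕ z_(a;b;c₁…cₙ) is a sum of elements z_𝐚′ with 𝐚′ ∈ I_{m,n}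
-- (adding c keeps odd entries odd and even entries even). As z_(a;b;c,c₁…cₙ) = z_c ⧢ z_(a;b;c₁…cₙ),
-- P_{m,n} gives P_{m,n+1}. All sums involved are p-integral, which is what allows multiplying
-- a family vanishing in 𝒜 by ζ(c).

module Submission where

open import Defs
open import Algebra.Bundles using (CommutativeMonoid)
import Algebra.Properties.CommutativeSemigroup as CommutativeSemigroupProperties
open import Data.Integer using (ℤ)
import Data.Integer as ℤ
import Data.Integer.Divisibility.Signed as ℤ∣
import Data.Integer.GCD as ℤ
import Data.Integer.Properties as ℤ
open import Data.List using (List; []; _∷_; [_]; map; _++_; concatMap; foldr; length)
open import Data.List.Relation.Unary.All as All using (All; []; _∷_)
import Data.List.Relation.Unary.All.Properties as All
open import Data.Nat using (ℕ; zero; suc; _≤_; _<_)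
import Data.Nat as ℕ
open import Data.Nat.Coprimality as Coprime using (Coprime; coprime-divisor)
open import Data.Nat.Divisibility using (_∣_; _∤_; divides; ∣-trans; ∣m⇒∣m*n; >⇒∤; _∣0)
open import Data.Nat.Primality using (Prime; euclidsLemma; prime⇒nonTrivial)
import Data.Nat.Properties as ℕ
open import Data.Nat.Tactic.RingSolver using (solve-∀)
open import Data.Product using (∃; _×_; _,_; proj₁; proj₂)
import Data.Product as Product
open import Data.Rational using (ℚ; mkℚ; 0ℚ; 1ℚ; _+_; _*_; -_; _/_; ↥_; ↧_; ↧ₙ_)
import Data.Rational.Properties as ℚ
open import Data.Rational.Solver using (module +-*-Solver)
open import Data.Sum using (inj₁; inj₂)
open import Data.Vec using (Vec; []; _∷_; toList)
import Data.Vec.Properties as Vec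
import Data.Vec.Relation.Unary.All as Vec
open import Data.Vec.Relation.Unary.All using ([]; _∷_)
open import Function using (_∘_)
open import Relation.Binary.PropositionalEquality hiding ([_])
open import Relation.Nullary using (contradiction)

open ≡-Reasoning
open +-*-Solver using (solve; _:+_; _:*_; _:=_; con; :-_)
open CommutativeSemigroupProperties
  (CommutativeMonoid.commutativeSemigroup ℚ.+-0-commutativeMonoid) using (interchange)
module ℤ* = CommutativeSemigroupProperties ℤ.*-commutativeSemigroup

private variable A B : Set

∑ : List A → (A → ℚ) → ℚ
∑ [] f = 0ℚ
∑ (x ∷ xs) f = f x + ∑ xs f

∑-cong : (xs : List A) {f g : A → ℚ} → (∀ x → f x ≡ g x) → ∑ xs f ≡ ∑ xs g
∑-cong [] eq = refl
∑-cong (x ∷ xs) eq = cong₂ _+_ (eq x) (∑-cong xs eq)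

∑-zero : (xs : List A) → ∑ xs (λ _ → 0ℚ) ≡ 0ℚ
∑-zero [] = refl
∑-zero (x ∷ xs) = trans (ℚ.+-identityˡ _) (∑-zero xs)

∑-++ : (xs ys : List A) (f : A → ℚ) → ∑ (xs ++ ys) f ≡ ∑ xs f + ∑ ys f
∑-++ [] ys f = sym (ℚ.+-identityˡ _)
∑-++ (x ∷ xs) ys f = trans (cong (f x +_) (∑-++ xs ys f)) (sym (ℚ.+-assoc (f x) _ _))

∑-+ : (xs : List A) (f g : A → ℚ) → ∑ xs (λ x → f x + g x) ≡ ∑ xs f + ∑ xs g
∑-+ [] f g = sym (ℚ.+-identityˡ 0ℚ)
∑-+ (x ∷ xs) f g = trans (cong (f x + g x +_) (∑-+ xs f g)) (interchange (f x) (g x) _ _)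

∑-cong-+ : (xs : List A) {f g h : A → ℚ} → (∀ x → f x ≡ g x + h x) → ∑ xs f ≡ ∑ xs g + ∑ xs h
∑-cong-+ xs eq = trans (∑-cong xs eq) (∑-+ xs _ _)

∑-*ˡ : (xs : List A) (c : ℚ) (f : A → ℚ) → ∑ xs (λ x → c * f x) ≡ c * ∑ xs f
∑-*ˡ [] c f = sym (ℚ.*-zeroʳ c)
∑-*ˡ (x ∷ xs) c f = trans (cong (c * f x +_) (∑-*ˡ xs c f)) (sym (ℚ.*-distribˡ-+ c _ _))

∑-map : (g : A → B) (xs : List A) (f : B → ℚ) → ∑ (map g xs) f ≡ ∑ xs (λ x → f (g x))
∑-map g [] f = refl
∑-map g (x ∷ xs) f = cong (f (g x) +_) (∑-map g xs f)

∑-concatMap : (g : A → List B) (xs : List A) (f : B → ℚ) →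
              ∑ (concatMap g xs) f ≡ ∑ xs (λ x → ∑ (g x) f)
∑-concatMap g [] f = refl
∑-concatMap g (x ∷ xs) f = trans (∑-++ (g x) (concatMap g xs) f) (cong (∑ (g x) f +_) (∑-concatMap g xs f))

∑-comm : (xs : List A) (ys : List B) (f : A → B → ℚ) →
         ∑ xs (λ x → ∑ ys (f x)) ≡ ∑ ys (λ y → ∑ xs (λ x → f x y))
∑-comm [] ys f = sym (∑-zero ys)
∑-comm (x ∷ xs) ys f = trans (cong (∑ ys (f x) +_) (∑-comm xs ys f)) (sym (∑-+ ys (f x) _))

∑-cong-All : {P : A → Set} (xs : List A) → All P xs → {f g : A → ℚ} → (∀ x → P x → f x ≡ g x) → ∑ xs f ≡ ∑ xs g
∑-cong-All [] [] eq = refl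
∑-cong-All (x ∷ xs) (px ∷ pxs) eq = cong₂ _+_ (eq x px) (∑-cong-All xs pxs eq)

sumBelow-cong : (N : ℕ) {f g : ℕ → ℚ} → (∀ j → f j ≡ g j) → sumBelow N f ≡ sumBelow N g
sumBelow-cong zero eq = refl
sumBelow-cong (suc N) eq = cong₂ _+_ (eq N) (sumBelow-cong N eq)

sumBelow-zero : (N : ℕ) → sumBelow N (λ _ → 0ℚ) ≡ 0ℚ
sumBelow-zero zero = refl
sumBelow-zero (suc N) = trans (ℚ.+-identityˡ _) (sumBelow-zero N)

sumBelow-+ : (N : ℕ) (f g : ℕ → ℚ) → sumBelow N (λ j → f j + g j) ≡ sumBelow N f + sumBelow N g
sumBelow-+ zero f g = sym (ℚ.+-identityˡ 0ℚ)
sumBelow-+ (suc N) f g = trans (cong (f N + g N +_) (sumBelow-+ N f g)) (interchange (f N) (g N) _ _)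

∑-sumBelow : (xs : List A) (N : ℕ) (f : A → ℕ → ℚ) →
             ∑ xs (λ x → sumBelow N (f x)) ≡ sumBelow N (λ j → ∑ xs (λ x → f x j))
∑-sumBelow [] N f = sym (sumBelow-zero N)
∑-sumBelow (x ∷ xs) N f =
  trans (cong (sumBelow N (f x) +_) (∑-sumBelow xs N f)) (sym (sumBelow-+ N (f x) _))

sumBelow-*-sumBelow : (N : ℕ) (a b : ℕ → ℚ) → sumBelow N a * sumBelow N b ≡
  sumBelow N (λ j → a j * sumBelow j b + b j * sumBelow j a + a j * b j)
sumBelow-*-sumBelow zero a b = ℚ.*-zeroˡ 0ℚ
sumBelow-*-sumBelow (suc N) a b = begin
  (a N + Sa) * (b N + Sb)
    ≡⟨ solve 4 (λ x Sx y Sy → (x :+ Sx) :* (y :+ Sy) := (x :* Sy :+ y :* Sx :+ x :* y) :+ Sx :* Sy)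
             refl (a N) Sa (b N) Sb ⟩
  (a N * Sb + b N * Sa + a N * b N) + Sa * Sb
    ≡⟨ cong (a N * Sb + b N * Sa + a N * b N +_) (sumBelow-*-sumBelow N a b) ⟩
  _ ∎
  where
  Sa = sumBelow N a
  Sb = sumBelow N b

-- Shuffles and contractions

∑⧢ : Word → Word → (Word → ℚ) → ℚ
∑⧢ u v f = ∑ (shuffleW u v) f

∑⧢-cons : ∀ a u b v (f : Word → ℚ) →
          ∑⧢ (a ∷ u) (b ∷ v) f ≡ ∑⧢ u (b ∷ v) (f ∘ (a ∷_)) + ∑⧢ (a ∷ u) v (f ∘ (b ∷_))
∑⧢-cons a u b v f = trans (∑-++ (map (a ∷_) (shuffleW u (b ∷ v))) _ f)
  (cong₂ _+_ (∑-map (a ∷_) (shuffleW u (b ∷ v)) f) (∑-map (b ∷_) (shuffleW (a ∷ u) v) f))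

∑⧢-[]ˡ : ∀ u (f : Word → ℚ) → ∑⧢ [] u f ≡ f u
∑⧢-[]ˡ u f = ℚ.+-identityʳ (f u)

∑⧢-[]ʳ : ∀ u (f : Word → ℚ) → ∑⧢ u [] f ≡ f u
∑⧢-[]ʳ [] f = ℚ.+-identityʳ (f [])
∑⧢-[]ʳ (a ∷ u) f = ℚ.+-identityʳ (f (a ∷ u))

∑⧢-comm : ∀ u v (f : Word → ℚ) → ∑⧢ u v f ≡ ∑⧢ v u f
∑⧢-comm [] v f = trans (∑⧢-[]ˡ v f) (sym (∑⧢-[]ʳ v f))
∑⧢-comm (a ∷ u) [] f = trans (∑⧢-[]ʳ (a ∷ u) f) (sym (∑⧢-[]ˡ (a ∷ u) f))
∑⧢-comm (a ∷ u) (b ∷ v) f = begin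
  ∑⧢ (a ∷ u) (b ∷ v) f                                    ≡⟨ ∑⧢-cons a u b v f ⟩
  ∑⧢ u (b ∷ v) (f ∘ (a ∷_)) + ∑⧢ (a ∷ u) v (f ∘ (b ∷_))
    ≡⟨ cong₂ _+_ (∑⧢-comm u (b ∷ v) _) (∑⧢-comm (a ∷ u) v _) ⟩
  ∑⧢ (b ∷ v) u (f ∘ (a ∷_)) + ∑⧢ v (a ∷ u) (f ∘ (b ∷_))  ≡⟨ ℚ.+-comm (∑⧢ (b ∷ v) u _) _ ⟩
  ∑⧢ v (a ∷ u) (f ∘ (b ∷_)) + ∑⧢ (b ∷ v) u (f ∘ (a ∷_))  ≡⟨ sym (∑⧢-cons b v a u f) ⟩
  ∑⧢ (b ∷ v) (a ∷ u) f                                    ∎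

⧢₃ˡ ⧢₃ʳ : Word → Word → Word → (Word → ℚ) → ℚ
⧢₃ˡ u v w f = ∑ (shuffleW v w) (λ x → ∑⧢ u x f)
⧢₃ʳ u v w f = ∑ (shuffleW u v) (λ x → ∑⧢ x w f)

⧢₃ˡ-cons : ∀ a u b v c w (f : Word → ℚ) → ⧢₃ˡ (a ∷ u) (b ∷ v) (c ∷ w) f ≡
  ⧢₃ˡ u (b ∷ v) (c ∷ w) (f ∘ (a ∷_)) + (⧢₃ˡ (a ∷ u) v (c ∷ w) (f ∘ (b ∷_)) + ⧢₃ˡ (a ∷ u) (b ∷ v) w (f ∘ (c ∷_)))
⧢₃ˡ-cons a u b v c w f = begin
  ⧢₃ˡ (a ∷ u) (b ∷ v) (c ∷ w) f
    ≡⟨ ∑⧢-cons b v c w (λ x → ∑⧢ (a ∷ u) x f) ⟩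
  ∑ (shuffleW v (c ∷ w)) (λ x → ∑⧢ (a ∷ u) (b ∷ x) f) + ∑ (shuffleW (b ∷ v) w) (λ x → ∑⧢ (a ∷ u) (c ∷ x) f)
    ≡⟨ cong₂ _+_ (∑-cong-+ (shuffleW v (c ∷ w)) (λ x → ∑⧢-cons a u b x f))
                 (∑-cong-+ (shuffleW (b ∷ v) w) (λ x → ∑⧢-cons a u c x f)) ⟩
  (P₁ + X₁) + (P₂ + X₂)
    ≡⟨ interchange P₁ X₁ P₂ X₂ ⟩
  (P₁ + P₂) + (X₁ + X₂)
    ≡⟨ cong (_+ (X₁ + X₂)) (sym (∑⧢-cons b v c w (λ x → ∑⧢ u x (f ∘ (a ∷_))))) ⟩
  _ ∎
  where
  X₁ = ⧢₃ˡ (a ∷ u) v (c ∷ w) (f ∘ (b ∷_))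
  X₂ = ⧢₃ˡ (a ∷ u) (b ∷ v) w (f ∘ (c ∷_))
  P₁ = ∑ (shuffleW v (c ∷ w)) (λ x → ∑⧢ u (b ∷ x) (f ∘ (a ∷_)))
  P₂ = ∑ (shuffleW (b ∷ v) w) (λ x → ∑⧢ u (c ∷ x) (f ∘ (a ∷_)))

⧢₃ʳ-cons : ∀ a u b v c w (f : Word → ℚ) → ⧢₃ʳ (a ∷ u) (b ∷ v) (c ∷ w) f ≡
  ⧢₃ʳ u (b ∷ v) (c ∷ w) (f ∘ (a ∷_)) + (⧢₃ʳ (a ∷ u) v (c ∷ w) (f ∘ (b ∷_)) + ⧢₃ʳ (a ∷ u) (b ∷ v) w (f ∘ (c ∷_)))
⧢₃ʳ-cons a u b v c w f = begin
  ⧢₃ʳ (a ∷ u) (b ∷ v) (c ∷ w) f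
    ≡⟨ ∑⧢-cons a u b v (λ x → ∑⧢ x (c ∷ w) f) ⟩
  ∑ (shuffleW u (b ∷ v)) (λ x → ∑⧢ (a ∷ x) (c ∷ w) f) + ∑ (shuffleW (a ∷ u) v) (λ x → ∑⧢ (b ∷ x) (c ∷ w) f)
    ≡⟨ cong₂ _+_ (∑-cong-+ (shuffleW u (b ∷ v)) (λ x → ∑⧢-cons a x c w f))
                 (∑-cong-+ (shuffleW (a ∷ u) v) (λ x → ∑⧢-cons b x c w f)) ⟩
  (Y₁ + Q₁) + (Y₂ + Q₂)
    ≡⟨ solve 4 (λ y₁ q₁ y₂ q₂ → (y₁ :+ q₁) :+ (y₂ :+ q₂) := y₁ :+ (y₂ :+ (q₁ :+ q₂))) refl Y₁ Q₁ Y₂ Q₂ ⟩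
  Y₁ + (Y₂ + (Q₁ + Q₂))
    ≡⟨ cong (λ z → Y₁ + (Y₂ + z)) (sym (∑⧢-cons a u b v (λ x → ∑⧢ x w (f ∘ (c ∷_))))) ⟩
  _ ∎
  where
  Y₁ = ⧢₃ʳ u (b ∷ v) (c ∷ w) (f ∘ (a ∷_))
  Y₂ = ⧢₃ʳ (a ∷ u) v (c ∷ w) (f ∘ (b ∷_))
  Q₁ = ∑ (shuffleW u (b ∷ v)) (λ x → ∑⧢ (a ∷ x) w (f ∘ (c ∷_)))
  Q₂ = ∑ (shuffleW (a ∷ u) v) (λ x → ∑⧢ (b ∷ x) w (f ∘ (c ∷_)))

∑⧢-assoc : ∀ u v w (f : Word → ℚ) → ⧢₃ˡ u v w f ≡ ⧢₃ʳ u v w f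
∑⧢-assoc [] v w f = trans (∑-cong (shuffleW v w) (λ x → ∑⧢-[]ˡ x f)) (sym (ℚ.+-identityʳ (∑⧢ v w f)))
∑⧢-assoc (a ∷ u) [] w f = refl
∑⧢-assoc (a ∷ u) (b ∷ v) [] f =
  trans (ℚ.+-identityʳ _) (sym (∑-cong (shuffleW (a ∷ u) (b ∷ v)) (λ x → ∑⧢-[]ʳ x f)))
∑⧢-assoc (a ∷ u) (b ∷ v) (c ∷ w) f = begin
  ⧢₃ˡ (a ∷ u) (b ∷ v) (c ∷ w) f ≡⟨ ⧢₃ˡ-cons a u b v c w f ⟩
  _ ≡⟨ cong₂ _+_ (∑⧢-assoc u (b ∷ v) (c ∷ w) _)
                 (cong₂ _+_ (∑⧢-assoc (a ∷ u) v (c ∷ w) _) (∑⧢-assoc (a ∷ u) (b ∷ v) w _)) ⟩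
  _ ≡⟨ sym (⧢₃ʳ-cons a u b v c w f) ⟩
  ⧢₃ʳ (a ∷ u) (b ∷ v) (c ∷ w) f ∎

contractions : ℕ → Word → FormalSum
contractions c [] = []
contractions c (k ∷ ks) = (k ℕ.+ c ∷ ks) ∷ map (k ∷_) (contractions c ks)

∂ : ℕ → (Word → ℚ) → Word → ℚ
∂ c f x = ∑ (contractions c x) f

∂-cons : ∀ c (f : Word → ℚ) a x → ∂ c f (a ∷ x) ≡ f (a ℕ.+ c ∷ x) + ∂ c (f ∘ (a ∷_)) x
∂-cons c f a x = cong (f (a ℕ.+ c ∷ x) +_) (∑-map (a ∷_) (contractions c x) f)

Leibniz : ℕ → Word → Word → (Word → ℚ) → ℚ
Leibniz c u v f = ∂ c (λ u′ → ∑⧢ u′ v f) u + ∂ c (λ v′ → ∑⧢ u v′ f) v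

∑⧢-∂-cons : ∀ c a u b v (f : Word → ℚ) → ∑⧢ (a ∷ u) (b ∷ v) (∂ c f) ≡
  (∑⧢ u (b ∷ v) (f ∘ (a ℕ.+ c ∷_)) + ∑⧢ u (b ∷ v) (∂ c (f ∘ (a ∷_))))
    + (∑⧢ (a ∷ u) v (f ∘ (b ℕ.+ c ∷_)) + ∑⧢ (a ∷ u) v (∂ c (f ∘ (b ∷_))))
∑⧢-∂-cons c a u b v f = trans (∑⧢-cons a u b v (∂ c f))
  (cong₂ _+_ (∑-cong-+ (shuffleW u (b ∷ v)) (∂-cons c f a)) (∑-cong-+ (shuffleW (a ∷ u) v) (∂-cons c f b)))

Leibniz-cons : ∀ c a u b v (f : Word → ℚ) → Leibniz c (a ∷ u) (b ∷ v) f ≡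
  (∑⧢ u (b ∷ v) (f ∘ (a ℕ.+ c ∷_)) + Leibniz c u (b ∷ v) (f ∘ (a ∷_)))
    + (∑⧢ (a ∷ u) v (f ∘ (b ℕ.+ c ∷_)) + Leibniz c (a ∷ u) v (f ∘ (b ∷_)))
Leibniz-cons c a u b v f = begin
  Leibniz c (a ∷ u) (b ∷ v) f
    ≡⟨ cong₂ _+_ (∂-cons c (λ u′ → ∑⧢ u′ (b ∷ v) f) a u) (∂-cons c (λ v′ → ∑⧢ (a ∷ u) v′ f) b v) ⟩
  (∑⧢ (a ℕ.+ c ∷ u) (b ∷ v) f + ∂ c (λ u′ → ∑⧢ (a ∷ u′) (b ∷ v) f) u)
    + (∑⧢ (a ∷ u) (b ℕ.+ c ∷ v) f + ∂ c (λ v′ → ∑⧢ (a ∷ u) (b ∷ v′) f) v)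
    ≡⟨ cong₂ _+_ (cong₂ _+_ (∑⧢-cons (a ℕ.+ c) u b v f) (∑-cong-+ (contractions c u) (λ u′ → ∑⧢-cons a u′ b v f)))
                 (cong₂ _+_ (∑⧢-cons a u (b ℕ.+ c) v f) (∑-cong-+ (contractions c v) (λ v′ → ∑⧢-cons a u b v′ f))) ⟩
  ((A₁ + A₂) + (E₁ + G₁)) + ((A₃ + A₄) + (G₂ + E₄))
    ≡⟨ solve 8 (λ A₁ A₂ A₃ A₄ E₁ E₄ G₁ G₂ →
                  ((A₁ :+ A₂) :+ (E₁ :+ G₁)) :+ ((A₃ :+ A₄) :+ (G₂ :+ E₄)) :=
                  (A₁ :+ (E₁ :+ (A₃ :+ G₂))) :+ (A₄ :+ ((A₂ :+ G₁) :+ E₄)))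
             refl A₁ A₂ A₃ A₄ E₁ E₄ G₁ G₂ ⟩
  (A₁ + (E₁ + (A₃ + G₂))) + (A₄ + ((A₂ + G₁) + E₄))
    ≡⟨ sym (cong₂ _+_ (cong (λ z → A₁ + (E₁ + z)) (∂-cons c (λ v′ → ∑⧢ u v′ (f ∘ (a ∷_))) b v))
                      (cong (λ z → A₄ + (z + E₄)) (∂-cons c (λ u′ → ∑⧢ u′ v (f ∘ (b ∷_))) a u))) ⟩
  _ ∎
  where
  A₁ = ∑⧢ u (b ∷ v) (f ∘ (a ℕ.+ c ∷_))
  A₂ = ∑⧢ (a ℕ.+ c ∷ u) v (f ∘ (b ∷_))
  A₃ = ∑⧢ u (b ℕ.+ c ∷ v) (f ∘ (a ∷_))
  A₄ = ∑⧢ (a ∷ u) v (f ∘ (b ℕ.+ c ∷_))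
  E₁ = ∂ c (λ u′ → ∑⧢ u′ (b ∷ v) (f ∘ (a ∷_))) u
  E₄ = ∂ c (λ v′ → ∑⧢ (a ∷ u) v′ (f ∘ (b ∷_))) v
  G₁ = ∂ c (λ u′ → ∑⧢ (a ∷ u′) v (f ∘ (b ∷_))) u
  G₂ = ∂ c (λ v′ → ∑⧢ u (b ∷ v′) (f ∘ (a ∷_))) v

∑⧢-∂ : ∀ c u v (f : Word → ℚ) → ∑⧢ u v (∂ c f) ≡ Leibniz c u v f
∑⧢-∂ c [] v f =
  trans (ℚ.+-identityʳ _) (sym (trans (ℚ.+-identityˡ _) (∑-cong (contractions c v) (λ v′ → ∑⧢-[]ˡ v′ f))))
∑⧢-∂ c (a ∷ u) [] f =
  trans (ℚ.+-identityʳ _) (sym (trans (ℚ.+-identityʳ _) (∑-cong (contractions c (a ∷ u)) (λ u′ → ∑⧢-[]ʳ u′ f))))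
∑⧢-∂ c (a ∷ u) (b ∷ v) f = begin
  ∑⧢ (a ∷ u) (b ∷ v) (∂ c f) ≡⟨ ∑⧢-∂-cons c a u b v f ⟩
  _ ≡⟨ cong₂ _+_ (cong (∑⧢ u (b ∷ v) (f ∘ (a ℕ.+ c ∷_)) +_) (∑⧢-∂ c u (b ∷ v) (f ∘ (a ∷_))))
                 (cong (∑⧢ (a ∷ u) v (f ∘ (b ℕ.+ c ∷_)) +_) (∑⧢-∂ c (a ∷ u) v (f ∘ (b ∷_)))) ⟩
  _ ≡⟨ sym (Leibniz-cons c a u b v f) ⟩
  Leibniz c (a ∷ u) (b ∷ v) f ∎

-- The harmonic product with one letter

invPow-+ : ∀ j k c → invPow j (k ℕ.+ c) ≡ invPow j k * invPow j c
invPow-+ j zero c = sym (ℚ.*-identityˡ _)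
invPow-+ j (suc k) c = trans (cong (1/j+1 *_) (invPow-+ j k c)) (sym (ℚ.*-assoc 1/j+1 (invPow j k) (invPow j c)))
  where 1/j+1 = ℤ.+ 1 / suc j

∑-zetaSum-cons : ∀ k M (S : FormalSum) →
  ∑ S (zetaSum (suc M) ∘ (k ∷_)) ≡ sumBelow M (λ j → invPow j k * ∑ S (zetaSum (suc j)))
∑-zetaSum-cons k M S = trans (∑-sumBelow S M (λ y j → invPow j k * zetaSum (suc j) y))
  (sumBelow-cong M (λ j → ∑-*ˡ S (invPow j k) (zetaSum (suc j))))

∑-zetaStarSum-cons : ∀ k M (S : FormalSum) →
  ∑ S (zetaStarSum (suc M) ∘ (k ∷_)) ≡ sumBelow M (λ j → invPow j k * ∑ S (zetaStarSum (suc (suc j))))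
∑-zetaStarSum-cons k M S = trans (∑-sumBelow S M (λ y j → invPow j k * zetaStarSum (suc (suc j)) y))
  (sumBelow-cong M (λ j → ∑-*ˡ S (invPow j k) (zetaStarSum (suc (suc j)))))

∑⧢-letter-cons : ∀ c k ks (f : Word → ℚ) → ∑⧢ (c ∷ []) (k ∷ ks) f ≡ f (c ∷ k ∷ ks) + ∑⧢ (c ∷ []) ks (f ∘ (k ∷_))
∑⧢-letter-cons c k ks f = trans (∑⧢-cons c [] k ks f) (cong (_+ ∑⧢ (c ∷ []) ks (f ∘ (k ∷_))) (∑⧢-[]ˡ (k ∷ ks) (f ∘ (c ∷_))))

zetaSum-stuffle₁-summand : ∀ c k ks j →
  ∑⧢ (c ∷ []) ks (zetaSum (suc j)) + ∂ c (zetaSum (suc j)) ks ≡ zetaSum (suc j) (c ∷ []) * zetaSum (suc j) ks →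
  (invPow j c * zetaSum (suc j) (k ∷ ks) + invPow j k * ∑⧢ (c ∷ []) ks (zetaSum (suc j)))
    + (invPow j (k ℕ.+ c) * zetaSum (suc j) ks + invPow j k * ∂ c (zetaSum (suc j)) ks)
  ≡ (invPow j c * 1ℚ) * zetaSum (suc j) (k ∷ ks) + (invPow j k * zetaSum (suc j) ks) * zetaSum (suc j) (c ∷ [])
    + (invPow j c * 1ℚ) * (invPow j k * zetaSum (suc j) ks)
zetaSum-stuffle₁-summand c k ks j ih = begin
  (ic * Zk + ik * S) + (invPow j (k ℕ.+ c) * Z + ik * C)
    ≡⟨ cong (λ x → (ic * Zk + ik * S) + (x * Z + ik * C)) (invPow-+ j k c) ⟩
  (ic * Zk + ik * S) + ((ik * ic) * Z + ik * C)
    ≡⟨ solve 6 (λ ic Zk ik S Z C → (ic :* Zk :+ ik :* S) :+ ((ik :* ic) :* Z :+ ik :* C) :=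
                  (ic :* Zk :+ (ik :* ic) :* Z) :+ ik :* (S :+ C))
             refl ic Zk ik S Z C ⟩
  (ic * Zk + (ik * ic) * Z) + ik * (S + C)
    ≡⟨ cong (λ y → (ic * Zk + (ik * ic) * Z) + ik * y) ih ⟩
  (ic * Zk + (ik * ic) * Z) + ik * (Zc * Z)
    ≡⟨ solve 5 (λ ic Zk ik Z Zc → (ic :* Zk :+ (ik :* ic) :* Z) :+ ik :* (Zc :* Z) :=
                  (ic :* con 1ℚ) :* Zk :+ (ik :* Z) :* Zc :+ (ic :* con 1ℚ) :* (ik :* Z))
             refl ic Zk ik Z Zc ⟩
  (ic * 1ℚ) * Zk + (ik * Z) * Zc + (ic * 1ℚ) * (ik * Z) ∎
  where
  ic = invPow j c
  ik = invPow j k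
  Z = zetaSum (suc j) ks
  Zk = zetaSum (suc j) (k ∷ ks)
  Zc = zetaSum (suc j) (c ∷ [])
  S = ∑⧢ (c ∷ []) ks (zetaSum (suc j))
  C = ∂ c (zetaSum (suc j)) ks

zetaSum-stuffle₁ : ∀ c w N → ∑⧢ (c ∷ []) w (zetaSum N) + ∂ c (zetaSum N) w ≡ zetaSum N (c ∷ []) * zetaSum N w
zetaSum-stuffle₁ c [] N = begin
  (zetaSum N (c ∷ []) + 0ℚ) + 0ℚ ≡⟨ trans (ℚ.+-identityʳ _) (ℚ.+-identityʳ _) ⟩
  zetaSum N (c ∷ [])             ≡⟨ sym (ℚ.*-identityʳ _) ⟩
  zetaSum N (c ∷ []) * 1ℚ        ∎
zetaSum-stuffle₁ c (k ∷ ks) zero = begin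
  ∑⧢ (c ∷ []) (k ∷ ks) (zetaSum 0) + ∂ c (zetaSum 0) (k ∷ ks)
    ≡⟨ cong₂ _+_ (trans (∑⧢-letter-cons c k ks (zetaSum 0)) (trans (ℚ.+-identityˡ _) (∑-zero (shuffleW (c ∷ []) ks))))
                 (trans (∂-cons c (zetaSum 0) k ks) (trans (ℚ.+-identityˡ _) (∑-zero (contractions c ks)))) ⟩
  0ℚ + 0ℚ                        ≡⟨ ℚ.+-identityˡ 0ℚ ⟩
  0ℚ                             ≡⟨ sym (ℚ.*-zeroˡ 0ℚ) ⟩
  0ℚ * 0ℚ                        ∎
zetaSum-stuffle₁ c (k ∷ ks) (suc M) = begin
  ∑⧢ (c ∷ []) (k ∷ ks) (zetaSum (suc M)) + ∂ c (zetaSum (suc M)) (k ∷ ks)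
    ≡⟨ cong₂ _+_ (trans (∑⧢-letter-cons c k ks (zetaSum (suc M)))
                        (cong (zetaSum (suc M) (c ∷ k ∷ ks) +_) (∑-zetaSum-cons k M (shuffleW (c ∷ []) ks))))
                 (trans (∂-cons c (zetaSum (suc M)) k ks)
                        (cong (zetaSum (suc M) (k ℕ.+ c ∷ ks) +_) (∑-zetaSum-cons k M (contractions c ks)))) ⟩
  _ ≡⟨ trans (cong₂ _+_ (sym (sumBelow-+ M _ _)) (sym (sumBelow-+ M _ _))) (sym (sumBelow-+ M _ _)) ⟩
  _ ≡⟨ sumBelow-cong M (λ j → zetaSum-stuffle₁-summand c k ks j (zetaSum-stuffle₁ c ks (suc j))) ⟩
  _ ≡⟨ sym (sumBelow-*-sumBelow M (λ j → invPow j c * 1ℚ) (λ j → invPow j k * zetaSum (suc j) ks)) ⟩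
  zetaSum (suc M) (c ∷ []) * zetaSum (suc M) (k ∷ ks) ∎

zetaStarSum-stuffle₁-summand : ∀ c k ks j →
  ∑⧢ (c ∷ []) ks (zetaStarSum (suc (suc j))) ≡
    zetaStarSum (suc (suc j)) (c ∷ []) * zetaStarSum (suc (suc j)) ks + ∂ c (zetaStarSum (suc (suc j))) ks →
  invPow j c * zetaStarSum (suc (suc j)) (k ∷ ks) + invPow j k * ∑⧢ (c ∷ []) ks (zetaStarSum (suc (suc j)))
  ≡ ((invPow j c * 1ℚ) * zetaStarSum (suc j) (k ∷ ks) + (invPow j k * zetaStarSum (suc (suc j)) ks) * zetaStarSum (suc j) (c ∷ [])
      + (invPow j c * 1ℚ) * (invPow j k * zetaStarSum (suc (suc j)) ks))
    + (invPow j (k ℕ.+ c) * zetaStarSum (suc (suc j)) ks + invPow j k * ∂ c (zetaStarSum (suc (suc j))) ks)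
zetaStarSum-stuffle₁-summand c k ks j ih = begin
  ic * (ik * Z + Zk) + ik * S
    ≡⟨ cong (λ y → ic * (ik * Z + Zk) + ik * y) ih ⟩
  ic * (ik * Z + Zk) + ik * ((ic * 1ℚ + Zc) * Z + C)
    ≡⟨ solve 6 (λ ic ik Z Zk Zc C → ic :* (ik :* Z :+ Zk) :+ ik :* ((ic :* con 1ℚ :+ Zc) :* Z :+ C) :=
                  ((ic :* con 1ℚ) :* Zk :+ (ik :* Z) :* Zc :+ (ic :* con 1ℚ) :* (ik :* Z)) :+ ((ik :* ic) :* Z :+ ik :* C))
             refl ic ik Z Zk Zc C ⟩
  ((ic * 1ℚ) * Zk + (ik * Z) * Zc + (ic * 1ℚ) * (ik * Z)) + ((ik * ic) * Z + ik * C)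
    ≡⟨ cong (λ x → ((ic * 1ℚ) * Zk + (ik * Z) * Zc + (ic * 1ℚ) * (ik * Z)) + (x * Z + ik * C)) (sym (invPow-+ j k c)) ⟩
  ((ic * 1ℚ) * Zk + (ik * Z) * Zc + (ic * 1ℚ) * (ik * Z)) + (invPow j (k ℕ.+ c) * Z + ik * C) ∎
  where
  ic = invPow j c
  ik = invPow j k
  Z = zetaStarSum (suc (suc j)) ks
  Zk = zetaStarSum (suc j) (k ∷ ks)
  Zc = zetaStarSum (suc j) (c ∷ [])
  S = ∑⧢ (c ∷ []) ks (zetaStarSum (suc (suc j)))
  C = ∂ c (zetaStarSum (suc (suc j))) ks

zetaStarSum-stuffle₁ : ∀ c w N →
  ∑⧢ (c ∷ []) w (zetaStarSum N) ≡ zetaStarSum N (c ∷ []) * zetaStarSum N w + ∂ c (zetaStarSum N) w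
zetaStarSum-stuffle₁ c [] N = begin
  zetaStarSum N (c ∷ []) + 0ℚ        ≡⟨ cong (_+ 0ℚ) (sym (ℚ.*-identityʳ (zetaStarSum N (c ∷ [])))) ⟩
  zetaStarSum N (c ∷ []) * 1ℚ + 0ℚ   ∎
zetaStarSum-stuffle₁ c (k ∷ ks) zero = begin
  ∑⧢ (c ∷ []) (k ∷ ks) (zetaStarSum 0)
    ≡⟨ trans (∑⧢-letter-cons c k ks (zetaStarSum 0)) (trans (ℚ.+-identityˡ _) (∑-zero (shuffleW (c ∷ []) ks))) ⟩
  0ℚ
    ≡⟨ sym (trans (cong₂ _+_ (ℚ.*-zeroˡ 0ℚ) (trans (∂-cons c (zetaStarSum 0) k ks)
                                               (trans (ℚ.+-identityˡ _) (∑-zero (contractions c ks)))))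
                  (ℚ.+-identityˡ 0ℚ)) ⟩
  0ℚ * 0ℚ + ∂ c (zetaStarSum 0) (k ∷ ks) ∎
zetaStarSum-stuffle₁ c (k ∷ ks) (suc M) = begin
  ∑⧢ (c ∷ []) (k ∷ ks) (zetaStarSum (suc M))
    ≡⟨ trans (∑⧢-letter-cons c k ks (zetaStarSum (suc M)))
             (cong (zetaStarSum (suc M) (c ∷ k ∷ ks) +_) (∑-zetaStarSum-cons k M (shuffleW (c ∷ []) ks))) ⟩
  _ ≡⟨ sym (sumBelow-+ M _ _) ⟩
  _ ≡⟨ sumBelow-cong M (λ j → zetaStarSum-stuffle₁-summand c k ks j (zetaStarSum-stuffle₁ c ks (suc (suc j)))) ⟩
  _ ≡⟨ trans (sumBelow-+ M _ _) (cong₂ _+_ (sym (sumBelow-*-sumBelow M a b)) (sumBelow-+ M _ _)) ⟩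
  zetaStarSum (suc M) (c ∷ []) * zetaStarSum (suc M) (k ∷ ks)
    + (zetaStarSum (suc M) (k ℕ.+ c ∷ ks) + sumBelow M (λ j → invPow j k * ∂ c (zetaStarSum (suc (suc j))) ks))
    ≡⟨ cong (zetaStarSum (suc M) (c ∷ []) * zetaStarSum (suc M) (k ∷ ks) +_)
            (sym (trans (∂-cons c (zetaStarSum (suc M)) k ks)
                        (cong (zetaStarSum (suc M) (k ℕ.+ c ∷ ks) +_) (∑-zetaStarSum-cons k M (contractions c ks))))) ⟩
  zetaStarSum (suc M) (c ∷ []) * zetaStarSum (suc M) (k ∷ ks) + ∂ c (zetaStarSum (suc M)) (k ∷ ks) ∎
  where
  a b : ℕ → ℚ
  a j = invPow j c * 1ℚ
  b j = invPow j k * zetaStarSum (suc (suc j)) ks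

∑-zetaSum-stuffle₁ : ∀ c (W : FormalSum) N →
  ∑ W (λ y → ∑⧢ (c ∷ []) y (zetaSum N)) + ∑ W (∂ c (zetaSum N)) ≡ zetaSum N (c ∷ []) * ∑ W (zetaSum N)
∑-zetaSum-stuffle₁ c W N = trans (sym (∑-+ W _ _))
  (trans (∑-cong W (λ y → zetaSum-stuffle₁ c y N)) (∑-*ˡ W (zetaSum N (c ∷ [])) (zetaSum N)))

∑-zetaStarSum-stuffle₁ : ∀ c (W : FormalSum) N →
  ∑ W (λ y → ∑⧢ (c ∷ []) y (zetaStarSum N)) ≡ zetaStarSum N (c ∷ []) * ∑ W (zetaStarSum N) + ∑ W (∂ c (zetaStarSum N))
∑-zetaStarSum-stuffle₁ c W N = trans (∑-cong-+ W (λ y → zetaStarSum-stuffle₁ c y N))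
  (cong (_+ ∑ W (∂ c (zetaStarSum N))) (∑-*ˡ W (zetaStarSum N (c ∷ [])) (zetaStarSum N)))

-- Contractions of the symmetrised words z_𝐚

∂-interleave : ∀ c σ τ → length σ ≡ length τ → (f : Word → ℚ) →
  ∂ c f (interleave σ τ) ≡ ∂ c (λ σ′ → f (interleave σ′ τ)) σ + ∂ c (λ τ′ → f (interleave σ τ′)) τ
∂-interleave c [] [] eq f = sym (ℚ.+-identityˡ 0ℚ)
∂-interleave c (x ∷ xs) (y ∷ ys) eq f = begin
  ∂ c f (x ∷ y ∷ interleave xs ys)
    ≡⟨ trans (∂-cons c f x _) (cong (T₁ +_) (∂-cons c (f ∘ (x ∷_)) y _)) ⟩
  T₁ + (T₂ + ∂ c (f ∘ (λ z → x ∷ y ∷ z)) (interleave xs ys))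
    ≡⟨ cong (λ z → T₁ + (T₂ + z)) (∂-interleave c xs ys (ℕ.suc-injective eq) (f ∘ (λ z → x ∷ y ∷ z))) ⟩
  T₁ + (T₂ + (T₃ + T₄))
    ≡⟨ solve 4 (λ t₁ t₂ t₃ t₄ → t₁ :+ (t₂ :+ (t₃ :+ t₄)) := (t₁ :+ t₃) :+ (t₂ :+ t₄)) refl T₁ T₂ T₃ T₄ ⟩
  (T₁ + T₃) + (T₂ + T₄)
    ≡⟨ sym (cong₂ _+_ (∂-cons c (λ σ′ → f (interleave σ′ (y ∷ ys))) x xs) (∂-cons c (λ τ′ → f (interleave (x ∷ xs) τ′)) y ys)) ⟩
  _ ∎
  where
  T₁ = f (x ℕ.+ c ∷ y ∷ interleave xs ys)
  T₂ = f (x ∷ y ℕ.+ c ∷ interleave xs ys)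
  T₃ = ∂ c (λ σ′ → f (x ∷ y ∷ interleave σ′ ys)) xs
  T₄ = ∂ c (λ τ′ → f (x ∷ y ∷ interleave xs τ′)) ys

∑-insertions-cons : ∀ x y ys (g : Word → ℚ) →
  ∑ (insertions x (y ∷ ys)) g ≡ g (x ∷ y ∷ ys) + ∑ (insertions x ys) (g ∘ (y ∷_))
∑-insertions-cons x y ys g = cong (g (x ∷ y ∷ ys) +_) (∑-map (y ∷_) (insertions x ys) g)

∑-insertions-∂ : ∀ c x ρ (g : Word → ℚ) →
  ∑ (insertions x ρ) (∂ c g) ≡ ∑ (insertions (x ℕ.+ c) ρ) g + ∂ c (λ ρ′ → ∑ (insertions x ρ′) g) ρ
∑-insertions-∂ c x [] g = refl
∑-insertions-∂ c x (y ∷ ys) g = begin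
  ∑ (insertions x (y ∷ ys)) (∂ c g)
    ≡⟨ ∑-insertions-cons x y ys (∂ c g) ⟩
  ∂ c g (x ∷ y ∷ ys) + ∑ (insertions x ys) (∂ c g ∘ (y ∷_))
    ≡⟨ cong₂ _+_ (trans (∂-cons c g x (y ∷ ys)) (cong (T₁ +_) (∂-cons c (g ∘ (x ∷_)) y ys)))
                 (∑-cong-+ (insertions x ys) (∂-cons c g y)) ⟩
  (T₁ + (T₂ + T₃)) + (T₄ + ∑ (insertions x ys) (∂ c (g ∘ (y ∷_))))
    ≡⟨ cong (λ z → (T₁ + (T₂ + T₃)) + (T₄ + z)) (∑-insertions-∂ c x ys (g ∘ (y ∷_))) ⟩
  (T₁ + (T₂ + T₃)) + (T₄ + (T₅ + T₆))
    ≡⟨ solve 6 (λ t₁ t₂ t₃ t₄ t₅ t₆ → (t₁ :+ (t₂ :+ t₃)) :+ (t₄ :+ (t₅ :+ t₆)) :=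
                  (t₁ :+ t₅) :+ ((t₂ :+ t₄) :+ (t₃ :+ t₆))) refl T₁ T₂ T₃ T₄ T₅ T₆ ⟩
  (T₁ + T₅) + ((T₂ + T₄) + (T₃ + T₆))
    ≡⟨ cong₂ _+_ (sym (∑-insertions-cons (x ℕ.+ c) y ys g))
                 (cong₂ _+_ (sym (∑-insertions-cons x (y ℕ.+ c) ys g))
                            (sym (∑-cong-+ (contractions c ys) (λ ρ′ → ∑-insertions-cons x y ρ′ g)))) ⟩
  ∑ (insertions (x ℕ.+ c) (y ∷ ys)) g
    + (∑ (insertions x (y ℕ.+ c ∷ ys)) g + ∂ c (λ ρ′ → ∑ (insertions x (y ∷ ρ′)) g) ys)
    ≡⟨ cong (∑ (insertions (x ℕ.+ c) (y ∷ ys)) g +_) (sym (∂-cons c (λ ρ′ → ∑ (insertions x ρ′) g) y ys)) ⟩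
  _ ∎
  where
  T₁ = g (x ℕ.+ c ∷ y ∷ ys)
  T₂ = g (x ∷ y ℕ.+ c ∷ ys)
  T₃ = ∂ c (λ z → g (x ∷ y ∷ z)) ys
  T₄ = ∑ (insertions x ys) (g ∘ (y ℕ.+ c ∷_))
  T₅ = ∑ (insertions (x ℕ.+ c) ys) (g ∘ (y ∷_))
  T₆ = ∂ c (λ ρ′ → ∑ (insertions x ρ′) (g ∘ (y ∷_))) ys

∑-perms-∂ : ∀ c a (g : Word → ℚ) → ∑ (perms a) (∂ c g) ≡ ∂ c (λ a′ → ∑ (perms a′) g) a
∑-perms-∂ c [] g = ℚ.+-identityʳ 0ℚ
∑-perms-∂ c (x ∷ xs) g = begin
  ∑ (concatMap (insertions x) (perms xs)) (∂ c g)
    ≡⟨ ∑-concatMap (insertions x) (perms xs) (∂ c g) ⟩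
  ∑ (perms xs) (λ ρ → ∑ (insertions x ρ) (∂ c g))
    ≡⟨ ∑-cong-+ (perms xs) (λ ρ → ∑-insertions-∂ c x ρ g) ⟩
  ∑ (perms xs) (λ ρ → ∑ (insertions (x ℕ.+ c) ρ) g) + ∑ (perms xs) (∂ c h)
    ≡⟨ cong₂ _+_ (sym (∑-concatMap (insertions (x ℕ.+ c)) (perms xs) g)) (∑-perms-∂ c xs h) ⟩
  ∑ (perms (x ℕ.+ c ∷ xs)) g + ∂ c (λ a′ → ∑ (perms a′) h) xs
    ≡⟨ cong (∑ (perms (x ℕ.+ c ∷ xs)) g +_)
            (∑-cong (contractions c xs) (λ a′ → sym (∑-concatMap (insertions x) (perms a′) g))) ⟩
  ∑ (perms (x ℕ.+ c ∷ xs)) g + ∂ c (λ a′ → ∑ (perms (x ∷ a′)) g) xs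
    ≡⟨ sym (∂-cons c (λ a′ → ∑ (perms a′) g) x xs) ⟩
  ∂ c (λ a′ → ∑ (perms a′) g) (x ∷ xs) ∎
  where
  h : Word → ℚ
  h ρ = ∑ (insertions x ρ) g

insertions-length : ∀ x ρ → All (λ σ → length σ ≡ suc (length ρ)) (insertions x ρ)
insertions-length x [] = refl ∷ []
insertions-length x (y ∷ ys) = refl ∷ All.map⁺ (All.map (cong suc) (insertions-length x ys))

perms-length : ∀ a → All (λ σ → length σ ≡ length a) (perms a)
perms-length [] = refl ∷ []
perms-length (x ∷ xs) = All.concat⁺ (All.map⁺ (All.map
  (λ {ρ} eq → All.map (λ e → trans e (cong suc eq)) (insertions-length x ρ)) (perms-length xs)))

interleavings : List ℕ → List ℕ → FormalSum
interleavings a b = concatMap (λ σ → map (interleave σ) (perms b)) (perms a)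

∑-interleavings : ∀ a b (f : Word → ℚ) →
  ∑ (interleavings a b) f ≡ ∑ (perms a) (λ σ → ∑ (perms b) (λ τ → f (interleave σ τ)))
∑-interleavings a b f = trans (∑-concatMap (λ σ → map (interleave σ) (perms b)) (perms a) f)
  (∑-cong (perms a) (λ σ → ∑-map (interleave σ) (perms b) f))

∑-interleavings-∂ : ∀ c a b → length a ≡ length b → (f : Word → ℚ) → ∑ (interleavings a b) (∂ c f) ≡
  ∂ c (λ a′ → ∑ (interleavings a′ b) f) a + ∂ c (λ b′ → ∑ (interleavings a b′) f) b
∑-interleavings-∂ c a b eq f = begin
  ∑ (interleavings a b) (∂ c f) ≡⟨ ∑-interleavings a b (∂ c f) ⟩
  ∑ (perms a) (λ σ → ∑ (perms b) (λ τ → ∂ c f (interleave σ τ)))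
    ≡⟨ ∑-cong-All (perms a) (perms-length a) (λ σ |σ| →
         trans (∑-cong-All (perms b) (perms-length b) (λ τ |τ| → ∂-interleave c σ τ (trans |σ| (trans eq (sym |τ|))) f))
               (∑-+ (perms b) _ _)) ⟩
  ∑ (perms a) (λ σ → ∑ (perms b) (λ τ → ∂ c (λ σ′ → f (interleave σ′ τ)) σ) + ∑ (perms b) (λ τ → ∂ c (λ τ′ → f (interleave σ τ′)) τ))
    ≡⟨ ∑-+ (perms a) _ _ ⟩
  ∑ (perms a) (λ σ → ∑ (perms b) (λ τ → ∂ c (λ σ′ → f (interleave σ′ τ)) σ))
    + ∑ (perms a) (λ σ → ∑ (perms b) (∂ c (λ τ′ → f (interleave σ τ′))))
    ≡⟨ cong₂ _+_ (trans (∑-cong (perms a) (λ σ → ∑-comm (perms b) (contractions c σ) (λ τ σ′ → f (interleave σ′ τ))))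
                        (∑-perms-∂ c a (λ σ′ → ∑ (perms b) (λ τ → f (interleave σ′ τ)))))
                 (trans (∑-cong (perms a) (λ σ → ∑-perms-∂ c b (λ τ′ → f (interleave σ τ′))))
                        (∑-comm (perms a) (contractions c b) _)) ⟩
  ∂ c (λ a′ → ∑ (perms a′) (λ σ → ∑ (perms b) (λ τ → f (interleave σ τ)))) a
    + ∂ c (λ b′ → ∑ (perms a) (λ σ → ∑ (perms b′) (λ τ → f (interleave σ τ)))) b
    ≡⟨ sym (cong₂ _+_ (∑-cong (contractions c a) (λ a′ → ∑-interleavings a′ b f))
                      (∑-cong (contractions c b) (λ b′ → ∑-interleavings a b′ f))) ⟩
  _ ∎

shuffleLetters : List ℕ → FormalSum
shuffleLetters cs = foldr (λ k acc → shuffle [ [ k ] ] acc) [ [] ] cs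

∑-shuffle : ∀ S T (f : Word → ℚ) → ∑ (shuffle S T) f ≡ ∑ S (λ u → ∑ T (λ v → ∑⧢ u v f))
∑-shuffle S T f = trans (∑-concatMap (λ u → concatMap (shuffleW u) T) S f)
  (∑-cong S (λ u → ∑-concatMap (shuffleW u) T f))

∑-shuffle-letter : ∀ k T (f : Word → ℚ) → ∑ (shuffle [ [ k ] ] T) f ≡ ∑ T (λ v → ∑⧢ (k ∷ []) v f)
∑-shuffle-letter k T f = trans (∑-shuffle [ [ k ] ] T f) (ℚ.+-identityʳ _)

∑-shuffleLetters-∂ : ∀ c cs (f : Word → ℚ) → ∑ (shuffleLetters cs) (∂ c f) ≡ ∂ c (λ cs′ → ∑ (shuffleLetters cs′) f) cs
∑-shuffleLetters-∂ c [] f = ℚ.+-identityʳ 0ℚ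
∑-shuffleLetters-∂ c (k ∷ ks) f = begin
  ∑ (shuffleLetters (k ∷ ks)) (∂ c f) ≡⟨ ∑-shuffle-letter k (shuffleLetters ks) (∂ c f) ⟩
  ∑ (shuffleLetters ks) (λ v → ∑⧢ (k ∷ []) v (∂ c f))
    ≡⟨ ∑-cong-+ (shuffleLetters ks) (λ v → trans (∑⧢-∂ c (k ∷ []) v f)
                                              (cong (_+ ∂ c (λ v′ → ∑⧢ (k ∷ []) v′ f) v) (ℚ.+-identityʳ (∑⧢ (k ℕ.+ c ∷ []) v f)))) ⟩
  ∑ (shuffleLetters ks) (λ v → ∑⧢ (k ℕ.+ c ∷ []) v f) + ∑ (shuffleLetters ks) (∂ c (λ v′ → ∑⧢ (k ∷ []) v′ f))
    ≡⟨ cong₂ _+_ (sym (∑-shuffle-letter (k ℕ.+ c) (shuffleLetters ks) f))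
                 (∑-shuffleLetters-∂ c ks (λ v′ → ∑⧢ (k ∷ []) v′ f)) ⟩
  ∑ (shuffleLetters (k ℕ.+ c ∷ ks)) f + ∂ c (λ cs′ → ∑ (shuffleLetters cs′) (λ v′ → ∑⧢ (k ∷ []) v′ f)) ks
    ≡⟨ cong (∑ (shuffleLetters (k ℕ.+ c ∷ ks)) f +_)
            (∑-cong (contractions c ks) (λ cs′ → sym (∑-shuffle-letter k (shuffleLetters cs′) f))) ⟩
  ∑ (shuffleLetters (k ℕ.+ c ∷ ks)) f + ∂ c (λ cs′ → ∑ (shuffleLetters (k ∷ cs′)) f) ks
    ≡⟨ sym (∂-cons c (λ cs′ → ∑ (shuffleLetters cs′) f) k ks) ⟩
  ∂ c (λ cs′ → ∑ (shuffleLetters cs′) f) (k ∷ ks) ∎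

∑-shuffle-shuffle-letter : ∀ c S T (f : Word → ℚ) →
  ∑ (shuffle S (shuffle [ [ c ] ] T)) f ≡ ∑ (shuffle S T) (λ y → ∑⧢ (c ∷ []) y f)
∑-shuffle-shuffle-letter c S T f = begin
  ∑ (shuffle S (shuffle [ [ c ] ] T)) f
    ≡⟨ ∑-shuffle S (shuffle [ [ c ] ] T) f ⟩
  ∑ S (λ u → ∑ (shuffle [ [ c ] ] T) (λ x → ∑⧢ u x f))
    ≡⟨ ∑-cong S (λ u → ∑-shuffle-letter c T (λ x → ∑⧢ u x f)) ⟩
  ∑ S (λ u → ∑ T (λ v → ⧢₃ˡ u (c ∷ []) v f))
    ≡⟨ ∑-cong S (λ u → ∑-cong T (λ v → letter-to-front u v)) ⟩
  ∑ S (λ u → ∑ T (λ v → ⧢₃ˡ (c ∷ []) u v f))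
    ≡⟨ sym (∑-shuffle S T (λ y → ∑⧢ (c ∷ []) y f)) ⟩
  ∑ (shuffle S T) (λ y → ∑⧢ (c ∷ []) y f) ∎
  where
  letter-to-front : ∀ u v → ⧢₃ˡ u (c ∷ []) v f ≡ ⧢₃ˡ (c ∷ []) u v f
  letter-to-front u v = begin
    ⧢₃ˡ u (c ∷ []) v f ≡⟨ ∑⧢-assoc u (c ∷ []) v f ⟩
    ⧢₃ʳ u (c ∷ []) v f ≡⟨ ∑⧢-comm u (c ∷ []) (λ x → ∑⧢ x v f) ⟩
    ⧢₃ʳ (c ∷ []) u v f ≡⟨ sym (∑⧢-assoc (c ∷ []) u v f) ⟩
    ⧢₃ˡ (c ∷ []) u v f ∎

zWords : List ℕ → List ℕ → List ℕ → FormalSum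
zWords a b cs = shuffle (interleavings a b) (shuffleLetters cs)

∑-zWords-∂ : ∀ c a b cs → length a ≡ length b → (f : Word → ℚ) → ∑ (zWords a b cs) (∂ c f) ≡
  ∂ c (λ a′ → ∑ (zWords a′ b cs) f) a + (∂ c (λ b′ → ∑ (zWords a b′ cs) f) b + ∂ c (λ cs′ → ∑ (zWords a b cs′) f) cs)
∑-zWords-∂ c a b cs eq f = begin
  ∑ (zWords a b cs) (∂ c f) ≡⟨ ∑-shuffle I L (∂ c f) ⟩
  ∑ I (λ u → ∑ L (λ v → ∑⧢ u v (∂ c f)))
    ≡⟨ ∑-cong-+ I (λ u → ∑-cong-+ L (λ v → ∑⧢-∂ c u v f)) ⟩
  ∑ I (λ u → ∑ L (λ v → ∂ c (λ u′ → ∑⧢ u′ v f) u)) + ∑ I (λ u → ∑ L (∂ c (λ v′ → ∑⧢ u v′ f)))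
    ≡⟨ cong₂ _+_ (trans (∑-cong I (λ u → ∑-comm L (contractions c u) (λ v u′ → ∑⧢ u′ v f)))
                        (∑-interleavings-∂ c a b eq G))
                 (trans (∑-cong I (λ u → ∑-shuffleLetters-∂ c cs (λ v′ → ∑⧢ u v′ f)))
                        (∑-comm I (contractions c cs) _)) ⟩
  (∂ c (λ a′ → ∑ (interleavings a′ b) G) a + ∂ c (λ b′ → ∑ (interleavings a b′) G) b)
    + ∂ c (λ cs′ → ∑ I (λ u → ∑ (shuffleLetters cs′) (λ v → ∑⧢ u v f))) cs
    ≡⟨ ℚ.+-assoc (∂ c (λ a′ → ∑ (interleavings a′ b) G) a) _ _ ⟩
  ∂ c (λ a′ → ∑ (interleavings a′ b) G) a + (∂ c (λ b′ → ∑ (interleavings a b′) G) b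
    + ∂ c (λ cs′ → ∑ I (λ u → ∑ (shuffleLetters cs′) (λ v → ∑⧢ u v f))) cs)
    ≡⟨ sym (cong₂ _+_ (∑-cong (contractions c a) (λ a′ → ∑-shuffle (interleavings a′ b) L f))
                      (cong₂ _+_ (∑-cong (contractions c b) (λ b′ → ∑-shuffle (interleavings a b′) L f))
                                 (∑-cong (contractions c cs) (λ cs′ → ∑-shuffle I (shuffleLetters cs′) f)))) ⟩
  _ ∎
  where
  I = interleavings a b
  L = shuffleLetters cs
  G : Word → ℚ
  G u′ = ∑ L (λ v → ∑⧢ u′ v f)

-- p-integral rationals and vanishing in 𝒜

record Integral (p : ℕ) (x : ℚ) : Set where
  constructor integral
  field p∤↧ : p ∤ ↧ₙ x

record VanishesMod (p : ℕ) (x : ℚ) : Set where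
  constructor vanishes
  field
    isIntegral : Integral p x
    p∣↥ : p ∣ ℤ.∣ ↥ x ∣

open Integral
open VanishesMod

↧-coprime-↥ : ∀ z → Coprime (↧ₙ z) ℤ.∣ ↥ z ∣
↧-coprime-↥ (mkℚ _ _ c) = Coprime.sym (Coprime.recompute c)

module _ {p : ℕ} (z : ℚ) (N : ℤ) (D : ℕ) (cross : ↥ z ℤ.* ℤ.+ D ≡ N ℤ.* ↧ z) where

  private
    cross-abs : ℤ.∣ ↥ z ∣ ℕ.* D ≡ ℤ.∣ N ∣ ℕ.* ↧ₙ z
    cross-abs = trans (sym (ℤ.abs-* (↥ z) (ℤ.+ D))) (trans (cong ℤ.∣_∣ cross) (ℤ.abs-* N (↧ z)))

  Integral-fraction : p ∤ D → Integral p z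
  Integral-fraction p∤D =
    integral λ p∣↧ → p∤D (∣-trans p∣↧ (coprime-divisor (↧-coprime-↥ z) (divides ℤ.∣ N ∣ cross-abs)))

  ∣numerator-fraction : Prime p → p ∤ D → p ∣ ℤ.∣ N ∣ → p ∣ ℤ.∣ ↥ z ∣
  ∣numerator-fraction pp p∤D p∣N
    with euclidsLemma ℤ.∣ ↥ z ∣ D pp (subst (p ∣_) (sym cross-abs) (∣m⇒∣m*n (↧ₙ z) p∣N))
  ... | inj₁ p∣↥ = p∣↥
  ... | inj₂ p∣D = contradiction p∣D p∤D

↥-/-cross : ∀ (i : ℤ) n .{{_ : ℕ.NonZero n}} → ↥ (i / n) ℤ.* ℤ.+ n ≡ i ℤ.* ↧ (i / n)
↥-/-cross i n = begin
  ↥ q ℤ.* ℤ.+ n                           ≡⟨ cong (↥ q ℤ.*_) (sym (ℚ.↧-/ i n)) ⟩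
  ↥ q ℤ.* (↧ q ℤ.* ℤ.gcd i (ℤ.+ n))       ≡⟨ ℤ*.x∙yz≈xz∙y (↥ q) (↧ q) _ ⟩
  (↥ q ℤ.* ℤ.gcd i (ℤ.+ n)) ℤ.* ↧ q       ≡⟨ cong (ℤ._* ↧ q) (ℚ.↥-/ i n) ⟩
  i ℤ.* ↧ q                               ∎
  where q = i / n

↥-+-cross : ∀ x y → ↥ (x + y) ℤ.* ℤ.+ (↧ₙ x ℕ.* ↧ₙ y) ≡ (↥ x ℤ.* ↧ y ℤ.+ ↥ y ℤ.* ↧ x) ℤ.* ↧ (x + y)
↥-+-cross (mkℚ n₁ d₁ _) (mkℚ n₂ d₂ _) = ↥-/-cross (n₁ ℤ.* ℤ.+ suc d₂ ℤ.+ n₂ ℤ.* ℤ.+ suc d₁) (suc d₁ ℕ.* suc d₂)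

↥-*-cross : ∀ x y → ↥ (x * y) ℤ.* ℤ.+ (↧ₙ x ℕ.* ↧ₙ y) ≡ (↥ x ℤ.* ↥ y) ℤ.* ↧ (x * y)
↥-*-cross (mkℚ n₁ d₁ _) (mkℚ n₂ d₂ _) = ↥-/-cross (n₁ ℤ.* n₂) (suc d₁ ℕ.* suc d₂)

module _ {p : ℕ} (pp : Prime p) where

  private
    ∤-* : ∀ {m n} → p ∤ m → p ∤ n → p ∤ m ℕ.* n
    ∤-* p∤m p∤n p∣mn with euclidsLemma _ _ pp p∣mn
    ... | inj₁ p∣m = p∤m p∣m
    ... | inj₂ p∣n = p∤n p∣n

  Integral-+ : ∀ {x y} → Integral p x → Integral p y → Integral p (x + y)
  Integral-+ {x} {y} ix iy = Integral-fraction (x + y) (↥ x ℤ.* ↧ y ℤ.+ ↥ y ℤ.* ↧ x) _ (↥-+-cross x y) (∤-* (p∤↧ ix) (p∤↧ iy))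

  Integral-* : ∀ {x y} → Integral p x → Integral p y → Integral p (x * y)
  Integral-* {x} {y} ix iy = Integral-fraction (x * y) (↥ x ℤ.* ↥ y) _ (↥-*-cross x y) (∤-* (p∤↧ ix) (p∤↧ iy))

  VanishesMod-+ : ∀ {x y} → VanishesMod p x → VanishesMod p y → VanishesMod p (x + y)
  VanishesMod-+ {x} {y} (vanishes ix p∣x) (vanishes iy p∣y) = vanishes (Integral-+ ix iy)
    (∣numerator-fraction (x + y) (↥ x ℤ.* ↧ y ℤ.+ ↥ y ℤ.* ↧ x) _ (↥-+-cross x y) pp (∤-* (p∤↧ ix) (p∤↧ iy))
      (ℤ∣.∣⇒∣ᵤ (ℤ∣.∣m∣n⇒∣m+n (ℤ∣.∣m⇒∣m*n {i = ℤ.+ p} {↥ x} (↧ y) (ℤ∣.∣ᵤ⇒∣ p∣x))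
                             (ℤ∣.∣m⇒∣m*n {i = ℤ.+ p} {↥ y} (↧ x) (ℤ∣.∣ᵤ⇒∣ p∣y)))))

  VanishesMod-* : ∀ {x y} → Integral p x → VanishesMod p y → VanishesMod p (x * y)
  VanishesMod-* {x} {y} ix (vanishes iy p∣y) = vanishes (Integral-* ix iy)
    (∣numerator-fraction (x * y) (↥ x ℤ.* ↥ y) _ (↥-*-cross x y) pp (∤-* (p∤↧ ix) (p∤↧ iy))
      (ℤ∣.∣⇒∣ᵤ (ℤ∣.∣n⇒∣m*n {i = ℤ.+ p} (↥ x) {↥ y} (ℤ∣.∣ᵤ⇒∣ p∣y))))

  Integral-1 : Integral p 1ℚ
  Integral-1 = integral (>⇒∤ (ℕ.nonTrivial⇒n>1 p {{prime⇒nonTrivial pp}}))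

  Integral-0 : Integral p 0ℚ
  Integral-0 = integral (p∤↧ Integral-1)

  VanishesMod-0 : VanishesMod p 0ℚ
  VanishesMod-0 = vanishes Integral-0 (p ∣0)

  Integral-invPow : ∀ j k → suc j < p → Integral p (invPow j k)
  Integral-invPow j zero j<p = Integral-1
  Integral-invPow j (suc k) j<p = Integral-* 1/j+1 (Integral-invPow j k j<p)
    where
    1/j+1 = Integral-fraction (ℤ.+ 1 / suc j) (ℤ.+ 1) (suc j) (↥-/-cross (ℤ.+ 1) (suc j)) (>⇒∤ j<p)

  Integral-sumBelow : ∀ M (f : ℕ → ℚ) → (∀ j → j < M → Integral p (f j)) → Integral p (sumBelow M f)
  Integral-sumBelow zero f h = Integral-0
  Integral-sumBelow (suc M) f h = Integral-+ (h M (ℕ.n<1+n M)) (Integral-sumBelow M f (λ j j<M → h j (ℕ.m<n⇒m<1+n j<M)))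

  Integral-∑ : (xs : List A) (f : A → ℚ) → (∀ x → Integral p (f x)) → Integral p (∑ xs f)
  Integral-∑ [] f h = Integral-0
  Integral-∑ (x ∷ xs) f h = Integral-+ (h x) (Integral-∑ xs f h)

  Integral-zetaSum : ∀ w N → N ≤ p → Integral p (zetaSum N w)
  Integral-zetaSum [] N N≤p = Integral-1
  Integral-zetaSum (k ∷ ks) zero N≤p = Integral-0
  Integral-zetaSum (k ∷ ks) (suc M) M<p = Integral-sumBelow M _ λ j j<M →
    let j<p = ℕ.<-≤-trans (ℕ.s≤s j<M) M<p in
    Integral-* (Integral-invPow j k j<p) (Integral-zetaSum ks (suc j) (ℕ.<⇒≤ j<p))

  Integral-zetaStarSum : ∀ w N → N ≤ p → Integral p (zetaStarSum N w)
  Integral-zetaStarSum [] N N≤p = Integral-1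
  Integral-zetaStarSum (k ∷ ks) zero N≤p = Integral-0
  Integral-zetaStarSum (k ∷ ks) (suc M) M<p = Integral-sumBelow M _ λ j j<M →
    let j<p = ℕ.<-≤-trans (ℕ.s≤s j<M) M<p in
    Integral-* (Integral-invPow j k j<p) (Integral-zetaStarSum ks (suc (suc j)) j<p)

VanishesMod-neg : ∀ {p x} → VanishesMod p x → VanishesMod p (- x)
VanishesMod-neg {p} {x} (vanishes ix p∣x) =
  vanishes (integral (p∤↧ ix ∘ subst (p ∣_) (cong ℤ.∣_∣ (ℚ.↧-neg x))))
           (subst (p ∣_) (sym (trans (cong ℤ.∣_∣ (ℚ.↥-neg x)) (ℤ.∣-i∣≡∣i∣ (↥ x)))) p∣x)

-- IsZeroA only constrains numerators; adding p-integrality makes vanishing in 𝒜 stable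
-- under multiplication by p-integral families.
VanishesInA : (ℕ → ℚ) → Set
VanishesInA x = ∃ λ N → ∀ p → Prime p → N < p → VanishesMod p (x p)

private variable x y w : ℕ → ℚ

VanishesInA⇒IsZeroA : VanishesInA x → IsZeroA x
VanishesInA⇒IsZeroA (N , h) = N , λ p pp N<p → p∣↥ (h p pp N<p)

IsZeroA⇒VanishesInA : (∀ p → Prime p → Integral p (x p)) → IsZeroA x → VanishesInA x
IsZeroA⇒VanishesInA ix (N , h) = N , λ p pp N<p → vanishes (ix p pp) (h p pp N<p)

VanishesInA-cong : (∀ p → x p ≡ y p) → VanishesInA x → VanishesInA y
VanishesInA-cong eq (N , h) = N , λ p pp N<p → subst (VanishesMod p) (eq p) (h p pp N<p)

VanishesInA-+ : VanishesInA x → VanishesInA y → VanishesInA (λ p → x p + y p)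
VanishesInA-+ (N , h) (M , g) = N ℕ.⊔ M , λ p pp N⊔M<p →
  VanishesMod-+ pp (h p pp (ℕ.≤-<-trans (ℕ.m≤m⊔n N M) N⊔M<p)) (g p pp (ℕ.≤-<-trans (ℕ.m≤n⊔m N M) N⊔M<p))

VanishesInA-neg : VanishesInA x → VanishesInA (λ p → - x p)
VanishesInA-neg (N , h) = N , λ p pp N<p → VanishesMod-neg (h p pp N<p)

VanishesInA-*ˡ : (∀ p → Prime p → Integral p (x p)) → VanishesInA y → VanishesInA (λ p → x p * y p)
VanishesInA-*ˡ ix (N , h) = N , λ p pp N<p → VanishesMod-* pp (ix p pp) (h p pp N<p)

VanishesInA-∑ : (xs : List A) (F : A → ℕ → ℚ) → All (VanishesInA ∘ F) xs → VanishesInA (λ p → ∑ xs (λ a → F a p))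
VanishesInA-∑ [] F [] = 0 , λ p pp _ → VanishesMod-0 pp
VanishesInA-∑ (a ∷ xs) F (va ∷ vxs) = VanishesInA-+ va (VanishesInA-∑ xs F vxs)

VanishesInA-cancelʳ : (∀ p → x p + y p ≡ w p) → VanishesInA y → VanishesInA w → VanishesInA x
VanishesInA-cancelʳ {x} {y} {w} eq vy vw = VanishesInA-cong x≡w-y (VanishesInA-+ vw (VanishesInA-neg vy))
  where
  x≡w-y : ∀ p → w p + - y p ≡ x p
  x≡w-y p = trans (cong (_+ - y p) (sym (eq p))) (solve 2 (λ a b → (a :+ b) :+ (:- b) := a) refl (x p) (y p))

-- Induction on the number of even entries

contractionsᵛ : ∀ {n} → ℕ → Vec ℕ n → List (Vec ℕ n)
contractionsᵛ c [] = []
contractionsᵛ c (k ∷ ks) = (k ℕ.+ c ∷ ks) ∷ map (k ∷_) (contractionsᵛ c ks)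

∂-toList : ∀ {n} c (v : Vec ℕ n) (F : Word → ℚ) → ∂ c F (toList v) ≡ ∑ (contractionsᵛ c v) (F ∘ toList)
∂-toList c [] F = refl
∂-toList c (k ∷ ks) F = cong (F (k ℕ.+ c ∷ toList ks) +_) (begin
  ∑ (map (k ∷_) (contractions c (toList ks))) F ≡⟨ ∑-map (k ∷_) (contractions c (toList ks)) F ⟩
  ∂ c (F ∘ (k ∷_)) (toList ks)                  ≡⟨ ∂-toList c ks (F ∘ (k ∷_)) ⟩
  ∑ (contractionsᵛ c ks) (F ∘ toList ∘ (k ∷_))   ≡⟨ sym (∑-map (k ∷_) (contractionsᵛ c ks) (F ∘ toList)) ⟩
  ∑ (map (k ∷_) (contractionsᵛ c ks)) (F ∘ toList) ∎)

All-contractionsᵛ : ∀ {n} {P : ℕ → Set} c → (∀ {k} → P k → P (k ℕ.+ c)) →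
                    {v : Vec ℕ n} → Vec.All P v → All (Vec.All P) (contractionsᵛ c v)
All-contractionsᵛ c P+c [] = []
All-contractionsᵛ c P+c (pk ∷ pks) = (P+c pk ∷ pks) ∷ All.map⁺ (All.map (pk ∷_) (All-contractionsᵛ c P+c pks))

OddPos-+ : ∀ {c k} → EvenPos c → OddPos k → OddPos (k ℕ.+ c)
OddPos-+ (i , refl) (j , refl) = j ℕ.+ suc i , distrib i j
  where
  distrib : ∀ i j → (2 ℕ.* j ℕ.+ 1) ℕ.+ 2 ℕ.* suc i ≡ 2 ℕ.* (j ℕ.+ suc i) ℕ.+ 1
  distrib = solve-∀

EvenPos-+ : ∀ {c k} → EvenPos c → EvenPos k → EvenPos (k ℕ.+ c)
EvenPos-+ (i , refl) (j , refl) = j ℕ.+ suc i , distrib i j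
  where
  distrib : ∀ i j → 2 ℕ.* suc j ℕ.+ 2 ℕ.* suc i ≡ 2 ℕ.* suc (j ℕ.+ suc i)
  distrib = solve-∀

∑-zElem-∂ : ∀ {m n} c (a b : Vec ℕ m) (cs : Vec ℕ n) (f : Word → ℚ) → ∑ (zElem a b cs) (∂ c f) ≡
  ∑ (contractionsᵛ c a) (λ a′ → ∑ (zElem a′ b cs) f)
    + (∑ (contractionsᵛ c b) (λ b′ → ∑ (zElem a b′ cs) f) + ∑ (contractionsᵛ c cs) (λ cs′ → ∑ (zElem a b cs′) f))
∑-zElem-∂ c a b cs f =
  trans (∑-zWords-∂ c (toList a) (toList b) (toList cs) (trans (Vec.length-toList a) (sym (Vec.length-toList b))) f)
        (cong₂ _+_ (∂-toList c a _) (cong₂ _+_ (∂-toList c b _) (∂-toList c cs _)))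

∑-zElem-cons : ∀ {m n} c (a b : Vec ℕ m) (cs : Vec ℕ n) (f : Word → ℚ) →
  ∑ (zElem a b (c ∷ cs)) f ≡ ∑ (zElem a b cs) (λ y → ∑⧢ (c ∷ []) y f)
∑-zElem-cons c a b cs = ∑-shuffle-shuffle-letter c (interleavings (toList a) (toList b)) (shuffleLetters (toList cs))

VanishesOnI : (ℕ → Word → ℚ) → ℕ → ℕ → Set
VanishesOnI ζ m n = ∀ (a b : Vec ℕ m) (cs : Vec ℕ n) → Vec.All OddPos a → Vec.All OddPos b → Vec.All EvenPos cs →
  VanishesInA (λ p → ∑ (zElem a b cs) (ζ p))

VanishesOnI-∂ : ∀ {m n} ζ → VanishesOnI ζ m n → ∀ {c} → EvenPos c → VanishesOnI (λ p → ∂ c (ζ p)) m n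
VanishesOnI-∂ ζ van {c} ec a b cs oa ob ecs =
  VanishesInA-cong (λ p → sym (∑-zElem-∂ c a b cs (ζ p)))
    (VanishesInA-+ (VanishesInA-∑ (contractionsᵛ c a) (λ a′ p → ∑ (zElem a′ b cs) (ζ p))
                     (All.map (λ oa′ → van _ b cs oa′ ob ecs) (All-contractionsᵛ c (OddPos-+ ec) oa)))
    (VanishesInA-+ (VanishesInA-∑ (contractionsᵛ c b) (λ b′ p → ∑ (zElem a b′ cs) (ζ p))
                     (All.map (λ ob′ → van a _ cs oa ob′ ecs) (All-contractionsᵛ c (OddPos-+ ec) ob)))
                   (VanishesInA-∑ (contractionsᵛ c cs) (λ cs′ p → ∑ (zElem a b cs′) (ζ p))
                     (All.map (λ ecs′ → van a b _ oa ob ecs′) (All-contractionsᵛ c (EvenPos-+ ec) ecs)))))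

VanishesOnI-zetaSum-suc : ∀ {m n} → VanishesOnI zetaSum m n → VanishesOnI zetaSum m (suc n)
VanishesOnI-zetaSum-suc van a b (c ∷ cs) oa ob (ec ∷ ecs) =
  VanishesInA-cancelʳ harmonic (VanishesOnI-∂ zetaSum van ec a b cs oa ob ecs)
    (VanishesInA-*ˡ (λ p pp → Integral-zetaSum pp (c ∷ []) p ℕ.≤-refl) (van a b cs oa ob ecs))
  where
  harmonic : ∀ p → ∑ (zElem a b (c ∷ cs)) (zetaSum p) + ∑ (zElem a b cs) (∂ c (zetaSum p)) ≡
                   zetaSum p (c ∷ []) * ∑ (zElem a b cs) (zetaSum p)
  harmonic p = trans (cong (_+ ∑ (zElem a b cs) (∂ c (zetaSum p))) (∑-zElem-cons c a b cs (zetaSum p)))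
                     (∑-zetaSum-stuffle₁ c (zElem a b cs) p)

VanishesOnI-zetaStarSum-suc : ∀ {m n} → VanishesOnI zetaStarSum m n → VanishesOnI zetaStarSum m (suc n)
VanishesOnI-zetaStarSum-suc van a b (c ∷ cs) oa ob (ec ∷ ecs) =
  VanishesInA-cong harmonic
    (VanishesInA-+ (VanishesInA-*ˡ (λ p pp → Integral-zetaStarSum pp (c ∷ []) p ℕ.≤-refl) (van a b cs oa ob ecs))
                   (VanishesOnI-∂ zetaStarSum van ec a b cs oa ob ecs))
  where
  harmonic : ∀ p → zetaStarSum p (c ∷ []) * ∑ (zElem a b cs) (zetaStarSum p) + ∑ (zElem a b cs) (∂ c (zetaStarSum p)) ≡
                   ∑ (zElem a b (c ∷ cs)) (zetaStarSum p)
  harmonic p = sym (trans (∑-zElem-cons c a b cs (zetaStarSum p)) (∑-zetaStarSum-stuffle₁ c (zElem a b cs) p))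

ZAp≡∑ : ∀ p w → ZAp p w ≡ ∑ w (zetaSum p)
ZAp≡∑ p [] = refl
ZAp≡∑ p (u ∷ w) = cong (zetaSum p u +_) (ZAp≡∑ p w)

ZbarAp≡∑ : ∀ p w → ZbarAp p w ≡ ∑ w (zetaStarSum p)
ZbarAp≡∑ p [] = refl
ZbarAp≡∑ p (u ∷ w) = cong (zetaStarSum p u +_) (ZbarAp≡∑ p w)

IsZeroA-cong : (∀ p → x p ≡ y p) → IsZeroA x → IsZeroA y
IsZeroA-cong eq (N , h) = N , λ p pp N<p → subst (λ z → p ∣ ℤ.∣ ↥ z ∣) (eq p) (h p pp N<p)

P⇒VanishesOnI : ∀ {m n} → P m n → VanishesOnI zetaSum m n × VanishesOnI zetaStarSum m n
P⇒VanishesOnI hP =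
  (λ a b cs oa ob ecs → IsZeroA⇒VanishesInA (λ p pp → Integral-∑ pp (zElem a b cs) (zetaSum p) (λ w → Integral-zetaSum pp w p ℕ.≤-refl))
                          (IsZeroA-cong (λ p → ZAp≡∑ p (zElem a b cs)) (proj₁ (hP a b cs oa ob ecs)))) ,
  (λ a b cs oa ob ecs → IsZeroA⇒VanishesInA (λ p pp → Integral-∑ pp (zElem a b cs) (zetaStarSum p) (λ w → Integral-zetaStarSum pp w p ℕ.≤-refl))
                          (IsZeroA-cong (λ p → ZbarAp≡∑ p (zElem a b cs)) (proj₂ (hP a b cs oa ob ecs))))

VanishesOnI⇒P : ∀ {m n} → VanishesOnI zetaSum m n × VanishesOnI zetaStarSum m n → P m n
VanishesOnI⇒P (van , van★) a b cs oa ob ecs =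
  VanishesInA⇒IsZeroA (VanishesInA-cong (λ p → sym (ZAp≡∑ p (zElem a b cs))) (van a b cs oa ob ecs)) ,
  VanishesInA⇒IsZeroA (VanishesInA-cong (λ p → sym (ZbarAp≡∑ p (zElem a b cs))) (van★ a b cs oa ob ecs))

lemma2p2 : (m : ℕ) → 1 ≤ m → P m 0 → (n : ℕ) → P m n
lemma2p2 m _ hP n = VanishesOnI⇒P (vanishing n)
  where
  vanishing : ∀ n → VanishesOnI zetaSum m n × VanishesOnI zetaStarSum m n
  vanishing zero = P⇒VanishesOnI hP
  vanishing (suc n) = Product.map VanishesOnI-zetaSum-suc VanishesOnI-zetaStarSum-suc (vanishing n)
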